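{- Let $\{s(n)\}_{n\ge 0}$ be Stern's sequence and $\{t(n)\}_{n\ge0}$ the twisted Stern sequence, with generating series $S(z)=\sum_{n\ge0}s(n)z^n$. Define the formal power series $U(z)=\sum_{n\ge0}u(n)z^n$ by $$U(z):=\frac{\sum_{n\geq 0}t(3+n)z^n}{S(z)}.$$ Then $\{u(n)\}_{n\ge0}$ is an integral sequence, and for all $e\geq 0$ we have $$\sum_{n\geq 0} t(3\cdot 2^e+n)z^n=(-1)^eS(z)\sum_{n\geq 0}u(n)z^{n\cdot 2^e}.$$
   Context: Stern's sequence is defined by $s(0)=0$, $s(1)=1$, and for $n\ge1$, $s(2n)=s(n)$, $s(2n+1)=s(n)+s(n+1)$. The twisted Stern sequence is defined by $t(0)=0$, $t(1)=1$, and for $n\ge1$, $t(2n)=-t(n)$, $t(2n+1)=-t(n)-t(n+1)$. All series are formal power series in $z$. -}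

module Defs where

open import Data.Nat using (ℕ; zero; suc; _∸_; _^_; _%_; _/_)
open import Data.Nat.Divisibility using (_∣?_; divides)
open import Data.Integer using (ℤ; 0ℤ; 1ℤ; _+_; _*_; -_)
open import Relation.Nullary using (yes; no)

-- Stern's sequence, computed with fuel (fuel n+1 is always enough for argument n).
sternF : ℕ → ℕ → ℤ
sternF zero _ = 0ℤ
sternF (suc f) zero = 0ℤ
sternF (suc f) (suc zero) = 1ℤ
sternF (suc f) (suc (suc k)) with k % 2
... | zero  = sternF f (suc (k / 2))                                    -- s(2(m+1)) = s(m+1)
... | suc _ = sternF f (suc (k / 2)) + sternF f (suc (suc (k / 2)))    -- s(2(m+1)+1) = s(m+1)+s(m+2)

s : ℕ → ℤ
s n = sternF (suc n) n

twistF : ℕ → ℕ → ℤ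
twistF zero _ = 0ℤ
twistF (suc f) zero = 0ℤ
twistF (suc f) (suc zero) = 1ℤ
twistF (suc f) (suc (suc k)) with k % 2
... | zero  = - twistF f (suc (k / 2))
... | suc _ = - twistF f (suc (k / 2)) + - twistF f (suc (suc (k / 2)))

t : ℕ → ℤ
t n = twistF (suc n) n

sumTo : ℕ → (ℕ → ℤ) → ℤ
sumTo zero f = 0ℤ
sumTo (suc n) f = sumTo n f + f n

conv : (ℕ → ℤ) → (ℕ → ℤ) → ℕ → ℤ
conv a b n = sumTo (suc n) (λ k → a k * b (n ∸ k))

-- Coefficients of  Σ_n u(n) z^(n·2^e).
spread : ℕ → (ℕ → ℤ) → ℕ → ℤ
spread e u n with (2 ^ e) ∣? n
... | yes (divides q _) = u q
... | no _ = 0ℤ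

module Submission where

-- Both claims are statements about coefficient sequences.
--  * Integrality: since s(0) = 0 and s(1) = 1 we have S(z) = z·S'(z) with S'
--    of constant term 1, and every series divides by a series of constant
--    term 1 (the quotient is built coefficient by coefficient).  The
--    constant term of the numerator, t(3), vanishes, so U := (Σ t(4+n) zⁿ)/S'
--    satisfies S·U = Σ t(3+n) zⁿ.
--  * Scaling: call q' the Stern doubling of q when q'(2m) = q(m) and
--    q'(2m+1) = q(m) + q(m+1).  The Stern recurrences say that convolving
--    with s turns dilation (v(z) ↦ v(z²)) into Stern doubling, while the
--    twisted recurrences say that n ↦ t(2c + n) is minus the Stern doubling
--    of n ↦ t(c + n) for c ≥ 1.  Induction on e with c = 3·2^e then gives
--    the identity, the base case e = 0 being the integrality claim.

open import Defs
open import Data.Nat using (ℕ; _^_)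
open import Data.Integer using (ℤ; -1ℤ) renaming (_*_ to _*ℤ_; _^_ to _^ℤ_)
open import Data.Product using (Σ; _×_)
open import Relation.Binary.PropositionalEquality using (_≡_)
open import Data.Nat using () renaming (_+_ to _+ℕ_; _*_ to _*ℕ_)

open import Data.Nat using (zero; suc; _∸_; _%_; _/_; _<_; _≤_; _<?_; s≤s; z≤n; NonZero)
open import Data.Nat.Properties
  using (≤-refl; ≤-trans; ≤-pred; n≤1+n; m≤m*n; ≤-antisym; ≮⇒≥; <-irrefl; m∸n≤m; +-suc; *-identityʳ;
         *-assoc; *-comm; *-cancelʳ-≡; m^n≢0; m*n≢0)
  renaming (*-distribʳ-+ to *ℕ-distribʳ-+; *-distribʳ-∸ to *ℕ-distribʳ-∸)
open import Data.Nat.DivMod using (m/n<m; m/n≤m; m*n%n≡0; m*n/n≡m; [m+kn]%n≡m%n; +-distrib-/-∣ʳ)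
open import Data.Nat.Divisibility using (divides; divides-refl; _∣?_)
open import Data.Integer using (0ℤ; 1ℤ; _+_; _-_; -_; _*_)
open import Data.Integer.Properties using (*-zeroʳ; *-identityˡ; *-distribʳ-+; +-identityˡ; +-identityʳ; -1*i≡-i; neg-distribˡ-*)
open import Data.Integer.Tactic.RingSolver using (solve-∀)
open import Data.Product using (_,_; proj₁; proj₂)
open import Data.Empty using (⊥-elim)
open import Relation.Nullary using (yes; no)
open import Relation.Binary.PropositionalEquality using (refl; sym; trans; cong; cong₂; module ≡-Reasoning)

byParity : (P : ℕ → Set) → (∀ m → P (m *ℕ 2)) → (∀ m → P (suc (m *ℕ 2))) → ∀ n → P n
byParity P even odd zero = even 0
byParity P even odd (suc zero) = odd 0
byParity P even odd (suc (suc n)) =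
  byParity (λ k → P (suc (suc k))) (λ m → even (suc m)) (λ m → odd (suc m)) n

Dilation : (ℕ → ℤ) → (ℕ → ℤ) → Set
Dilation v w = (∀ m → w (m *ℕ 2) ≡ v m) × (∀ m → w (suc (m *ℕ 2)) ≡ 0ℤ)

SternDoubling : (ℕ → ℤ) → (ℕ → ℤ) → Set
SternDoubling q q' = (∀ m → q' (m *ℕ 2) ≡ q m) × (∀ m → q' (suc (m *ℕ 2)) ≡ q m + q (suc m))

double%2 : ∀ m → (m *ℕ 2) % 2 ≡ 0
double%2 m = m*n%n≡0 m 2

double/2 : ∀ m → (m *ℕ 2) / 2 ≡ m
double/2 m = m*n/n≡m m 2

sucDouble%2 : ∀ m → suc (m *ℕ 2) % 2 ≡ 1
sucDouble%2 m = [m+kn]%n≡m%n 1 m 2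

sucDouble/2 : ∀ m → suc (m *ℕ 2) / 2 ≡ m
sucDouble/2 m = trans (+-distrib-/-∣ʳ 1 {d = 2} (divides-refl m)) (double/2 m)

-- The two recursive calls made at argument k+3 stay below any sufficient fuel.
halvesBelow : ∀ k f → suc (suc (suc k)) ≤ f → suc (suc k / 2) < f × suc (suc (suc k / 2)) < f
halvesBelow k f le =
  ≤-trans (s≤s (s≤s (m/n≤m (suc k) 2))) le , ≤-trans (s≤s (s≤s (m/n<m (suc k) 2 (s≤s (s≤s z≤n))))) le

sternF-fuel : ∀ f g n → n < f → n < g → sternF f n ≡ sternF g n
sternF-fuel (suc f) (suc g) zero _ _ = refl
sternF-fuel (suc f) (suc g) (suc zero) _ _ = refl
sternF-fuel (suc f) (suc g) (suc (suc zero)) (s≤s p) (s≤s q) = sternF-fuel f g 1 p q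
sternF-fuel (suc f) (suc g) (suc (suc (suc k))) (s≤s p) (s≤s q) with suc k % 2
... | zero = sternF-fuel f g _ (proj₁ (halvesBelow k f p)) (proj₁ (halvesBelow k g q))
... | suc _ = cong₂ _+_ (sternF-fuel f g _ (proj₁ (halvesBelow k f p)) (proj₁ (halvesBelow k g q)))
                        (sternF-fuel f g _ (proj₂ (halvesBelow k f p)) (proj₂ (halvesBelow k g q)))

twistF-fuel : ∀ f g n → n < f → n < g → twistF f n ≡ twistF g n
twistF-fuel (suc f) (suc g) zero _ _ = refl
twistF-fuel (suc f) (suc g) (suc zero) _ _ = refl
twistF-fuel (suc f) (suc g) (suc (suc zero)) (s≤s p) (s≤s q) = cong -_ (twistF-fuel f g 1 p q)
twistF-fuel (suc f) (suc g) (suc (suc (suc k))) (s≤s p) (s≤s q) with suc k % 2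
... | zero = cong -_ (twistF-fuel f g _ (proj₁ (halvesBelow k f p)) (proj₁ (halvesBelow k g q)))
... | suc _ = cong₂ (λ a b → - a + - b)
                (twistF-fuel f g _ (proj₁ (halvesBelow k f p)) (proj₁ (halvesBelow k g q)))
                (twistF-fuel f g _ (proj₂ (halvesBelow k f p)) (proj₂ (halvesBelow k g q)))

sternF-even : ∀ f k → k % 2 ≡ 0 → sternF (suc f) (suc (suc k)) ≡ sternF f (suc (k / 2))
sternF-even f k h with k % 2
sternF-even f k h | zero = refl

sternF-odd : ∀ f k → k % 2 ≡ 1 → sternF (suc f) (suc (suc k)) ≡ sternF f (suc (k / 2)) + sternF f (suc (suc (k / 2)))
sternF-odd f k h with k % 2
sternF-odd f k h | suc _ = refl

twistF-even : ∀ f k → k % 2 ≡ 0 → twistF (suc f) (suc (suc k)) ≡ - twistF f (suc (k / 2))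
twistF-even f k h with k % 2
twistF-even f k h | zero = refl

twistF-odd : ∀ f k → k % 2 ≡ 1 → twistF (suc f) (suc (suc k)) ≡ - twistF f (suc (k / 2)) + - twistF f (suc (suc (k / 2)))
twistF-odd f k h with k % 2
twistF-odd f k h | suc _ = refl

-- Stern's recurrences, valid for every m (both sides vanish at m = 0).
s-even : ∀ m → s (m *ℕ 2) ≡ s m
s-even zero = refl
s-even (suc m) = begin
  sternF (suc (suc (suc (m *ℕ 2)))) (suc (suc (m *ℕ 2)))  ≡⟨ sternF-even _ (m *ℕ 2) (double%2 m) ⟩
  sternF (suc (suc (m *ℕ 2))) (suc (m *ℕ 2 / 2))          ≡⟨ cong (λ x → sternF (suc (suc (m *ℕ 2))) (suc x)) (double/2 m) ⟩
  sternF (suc (suc (m *ℕ 2))) (suc m)                      ≡⟨ sternF-fuel _ _ (suc m) (s≤s (s≤s (m≤m*n m 2))) ≤-refl ⟩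
  s (suc m)                                               ∎
  where open ≡-Reasoning

s-odd : ∀ m → s (suc (m *ℕ 2)) ≡ s m + s (suc m)
s-odd zero = refl
s-odd (suc m) = begin
  sternF (suc F) (suc F')                                   ≡⟨ sternF-odd _ (suc (m *ℕ 2)) (sucDouble%2 m) ⟩
  sternF F (suc (suc (m *ℕ 2) / 2)) + sternF F (suc (suc (suc (m *ℕ 2) / 2)))
                                                            ≡⟨ cong (λ x → sternF F (suc x) + sternF F (suc (suc x))) (sucDouble/2 m) ⟩
  sternF F (suc m) + sternF F (suc (suc m))                 ≡⟨ cong₂ _+_ (sternF-fuel _ _ (suc m) (s≤s (s≤s (≤-trans (m≤m*n m 2) (n≤1+n _)))) ≤-refl)
                                                                          (sternF-fuel _ _ (suc (suc m)) (s≤s (s≤s (s≤s (m≤m*n m 2)))) ≤-refl) ⟩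
  s (suc m) + s (suc (suc m))                               ∎
  where
  open ≡-Reasoning
  F' = suc (suc (m *ℕ 2))
  F = suc F'

t-even : ∀ m .{{_ : NonZero m}} → t (m *ℕ 2) ≡ - t m
t-even (suc m) = begin
  twistF (suc (suc (suc (m *ℕ 2)))) (suc (suc (m *ℕ 2)))  ≡⟨ twistF-even _ (m *ℕ 2) (double%2 m) ⟩
  - twistF (suc (suc (m *ℕ 2))) (suc (m *ℕ 2 / 2))        ≡⟨ cong (λ x → - twistF (suc (suc (m *ℕ 2))) (suc x)) (double/2 m) ⟩
  - twistF (suc (suc (m *ℕ 2))) (suc m)                    ≡⟨ cong -_ (twistF-fuel _ _ (suc m) (s≤s (s≤s (m≤m*n m 2))) ≤-refl) ⟩
  - t (suc m)                                             ∎
  where open ≡-Reasoning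

t-odd : ∀ m .{{_ : NonZero m}} → t (suc (m *ℕ 2)) ≡ - t m + - t (suc m)
t-odd (suc m) = begin
  twistF (suc F) (suc F')                                   ≡⟨ twistF-odd _ (suc (m *ℕ 2)) (sucDouble%2 m) ⟩
  - twistF F (suc (suc (m *ℕ 2) / 2)) + - twistF F (suc (suc (suc (m *ℕ 2) / 2)))
                                                            ≡⟨ cong (λ x → - twistF F (suc x) + - twistF F (suc (suc x))) (sucDouble/2 m) ⟩
  - twistF F (suc m) + - twistF F (suc (suc m))             ≡⟨ cong₂ (λ a b → - a + - b)
                                                                 (twistF-fuel _ _ (suc m) (s≤s (s≤s (≤-trans (m≤m*n m 2) (n≤1+n _)))) ≤-refl)
                                                                 (twistF-fuel _ _ (suc (suc m)) (s≤s (s≤s (s≤s (m≤m*n m 2)))) ≤-refl) ⟩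
  - t (suc m) + - t (suc (suc m))                           ∎
  where
  open ≡-Reasoning
  F' = suc (suc (m *ℕ 2))
  F = suc F'

sumTo-cong : ∀ n {f g : ℕ → ℤ} → (∀ i → i < n → f i ≡ g i) → sumTo n f ≡ sumTo n g
sumTo-cong zero _ = refl
sumTo-cong (suc n) h = cong₂ _+_ (sumTo-cong n (λ i i<n → h i (≤-trans i<n (n≤1+n _)))) (h n ≤-refl)

sumTo-zero : ∀ n {f : ℕ → ℤ} → (∀ i → i < n → f i ≡ 0ℤ) → sumTo n f ≡ 0ℤ
sumTo-zero zero _ = refl
sumTo-zero (suc n) h = cong₂ _+_ (sumTo-zero n (λ i i<n → h i (≤-trans i<n (n≤1+n _)))) (h n ≤-refl)

sumTo-+ : ∀ n (f g : ℕ → ℤ) → sumTo n (λ i → f i + g i) ≡ sumTo n f + sumTo n g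
sumTo-+ zero f g = refl
sumTo-+ (suc n) f g = trans (cong (_+ (f n + g n)) (sumTo-+ n f g)) (interchange (sumTo n f) (sumTo n g) (f n) (g n))
  where
  interchange : ∀ (a b c d : ℤ) → (a + b) + (c + d) ≡ (a + c) + (b + d)
  interchange = solve-∀

sumTo-shift : ∀ n (f : ℕ → ℤ) → sumTo (suc n) f ≡ f 0 + sumTo n (λ i → f (suc i))
sumTo-shift zero f = comm (f 0)
  where
  comm : ∀ (a : ℤ) → 0ℤ + a ≡ a + 0ℤ
  comm = solve-∀
sumTo-shift (suc n) f = trans (cong (_+ f (suc n)) (sumTo-shift n f)) (assoc (f 0) _ _)
  where
  assoc : ∀ (a b c : ℤ) → (a + b) + c ≡ a + (b + c)
  assoc = solve-∀

sumTo-parity : ∀ n (f : ℕ → ℤ) →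
  sumTo (n *ℕ 2) f ≡ sumTo n (λ i → f (i *ℕ 2)) + sumTo n (λ i → f (suc (i *ℕ 2)))
sumTo-parity zero f = refl
sumTo-parity (suc n) f =
  trans (cong (λ x → (x + f (n *ℕ 2)) + f (suc (n *ℕ 2))) (sumTo-parity n f))
        (rearrange (sumTo n (λ i → f (i *ℕ 2))) (sumTo n (λ i → f (suc (i *ℕ 2)))) (f (n *ℕ 2)) (f (suc (n *ℕ 2))))
  where
  rearrange : ∀ (a b c d : ℤ) → ((a + b) + c) + d ≡ (a + c) + (b + d)
  rearrange = solve-∀

sumTo-parity-suc : ∀ n (f : ℕ → ℤ) →
  sumTo (suc (n *ℕ 2)) f ≡ sumTo (suc n) (λ i → f (i *ℕ 2)) + sumTo n (λ i → f (suc (i *ℕ 2)))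
sumTo-parity-suc n f = trans (cong (_+ f (n *ℕ 2)) (sumTo-parity n f))
  (rearrange (sumTo n (λ i → f (i *ℕ 2))) (sumTo n (λ i → f (suc (i *ℕ 2)))) (f (n *ℕ 2)))
  where
  rearrange : ∀ (a b c : ℤ) → (a + b) + c ≡ (a + c) + b
  rearrange = solve-∀

conv-congʳ : ∀ b {v w : ℕ → ℤ} → (∀ n → v n ≡ w n) → ∀ n → conv b v n ≡ conv b w n
conv-congʳ b h n = sumTo-cong (suc n) (λ k _ → cong (b k *_) (h (n ∸ k)))

conv-suc : ∀ b v n → b 0 ≡ 0ℤ → conv b v (suc n) ≡ conv (λ k → b (suc k)) v n
conv-suc b v n b₀ =
  trans (sumTo-shift (suc n) _) (trans (cong (λ x → x * v (suc n) + conv (λ k → b (suc k)) v n) b₀) (+-identityˡ _))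

double∸double : ∀ m i → m *ℕ 2 ∸ i *ℕ 2 ≡ (m ∸ i) *ℕ 2
double∸double m i = sym (*ℕ-distribʳ-∸ 2 m i)

double∸sucDouble : ∀ m i → i < m → m *ℕ 2 ∸ suc (i *ℕ 2) ≡ suc ((m ∸ suc i) *ℕ 2)
double∸sucDouble (suc m) zero _ = refl
double∸sucDouble (suc m) (suc i) (s≤s i<m) = double∸sucDouble m i i<m

sucDouble∸double : ∀ m i → i ≤ m → suc (m *ℕ 2) ∸ i *ℕ 2 ≡ suc ((m ∸ i) *ℕ 2)
sucDouble∸double m zero _ = refl
sucDouble∸double (suc m) (suc i) (s≤s i≤m) = sucDouble∸double m i i≤m

conv-dilation : ∀ {v w} → Dilation v w → SternDoubling (conv s v) (conv s w)
conv-dilation {v} {w} (wEven , wOdd) = evenCoeff , oddCoeff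
  where
  open ≡-Reasoning

  evenCoeff : ∀ m → conv s w (m *ℕ 2) ≡ conv s v m
  evenCoeff m = begin
    conv s w (m *ℕ 2)
      ≡⟨ sumTo-parity-suc m _ ⟩
    sumTo (suc m) (λ i → s (i *ℕ 2) * w (m *ℕ 2 ∸ i *ℕ 2)) + sumTo m (λ i → s (suc (i *ℕ 2)) * w (m *ℕ 2 ∸ suc (i *ℕ 2)))
      ≡⟨ cong₂ _+_ (sumTo-cong (suc m) (λ i _ → cong₂ _*_ (s-even i) (trans (cong w (double∸double m i)) (wEven (m ∸ i)))))
                   (sumTo-zero m (λ i i<m → trans (cong (λ x → s (suc (i *ℕ 2)) * w x) (double∸sucDouble m i i<m))
                                                  (trans (cong (s (suc (i *ℕ 2)) *_) (wOdd (m ∸ suc i))) (*-zeroʳ (s (suc (i *ℕ 2))))))) ⟩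
    conv s v m + 0ℤ
      ≡⟨ +-identityʳ _ ⟩
    conv s v m ∎

  oddCoeff : ∀ m → conv s w (suc (m *ℕ 2)) ≡ conv s v m + conv s v (suc m)
  oddCoeff m = begin
    conv s w (suc (m *ℕ 2))
      ≡⟨ sumTo-parity (suc m) _ ⟩
    sumTo (suc m) (λ i → s (i *ℕ 2) * w (suc (m *ℕ 2) ∸ i *ℕ 2)) + sumTo (suc m) (λ i → s (suc (i *ℕ 2)) * w (m *ℕ 2 ∸ i *ℕ 2))
      ≡⟨ cong₂ _+_ (sumTo-zero (suc m) (λ i i≤m → trans (cong (λ x → s (i *ℕ 2) * w x) (sucDouble∸double m i (≤-pred i≤m)))
                                                         (trans (cong (s (i *ℕ 2) *_) (wOdd (m ∸ i))) (*-zeroʳ (s (i *ℕ 2))))))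
                   (sumTo-cong (suc m) (λ i _ → trans (cong₂ _*_ (s-odd i) (trans (cong w (double∸double m i)) (wEven (m ∸ i))))
                                                      (*-distribʳ-+ (v (m ∸ i)) (s i) (s (suc i))))) ⟩
    0ℤ + sumTo (suc m) (λ i → s i * v (m ∸ i) + s (suc i) * v (m ∸ i))
      ≡⟨ +-identityˡ _ ⟩
    sumTo (suc m) (λ i → s i * v (m ∸ i) + s (suc i) * v (m ∸ i))
      ≡⟨ sumTo-+ (suc m) _ _ ⟩
    conv s v m + conv (λ k → s (suc k)) v m
      ≡⟨ cong (conv s v m +_) (sym (conv-suc s v m refl)) ⟩
    conv s v m + conv s v (suc m) ∎

spread-zero : ∀ u n → spread 0 u n ≡ u n
spread-zero u n with 1 ∣? n
... | yes (divides q eq) = cong u (sym (trans eq (*-identityʳ q)))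
... | no ¬1∣n = ⊥-elim (¬1∣n (divides n (sym (*-identityʳ n))))

spread-dilation : ∀ e u → Dilation (spread e u) (spread (suc e) u)
spread-dilation e u = spreadEven , spreadOdd
  where
  regroup : ∀ q → q *ℕ (2 *ℕ 2 ^ e) ≡ q *ℕ 2 ^ e *ℕ 2
  regroup q = trans (cong (q *ℕ_) (*-comm 2 (2 ^ e))) (sym (*-assoc q (2 ^ e) 2))

  cancel2 : ∀ {a b} → a *ℕ 2 ≡ b *ℕ 2 → a ≡ b
  cancel2 {a} {b} = *-cancelʳ-≡ a b 2

  spreadEven : ∀ m → spread (suc e) u (m *ℕ 2) ≡ spread e u m
  spreadEven m with (2 ^ suc e) ∣? (m *ℕ 2) | (2 ^ e) ∣? m
  ... | yes (divides q eq) | yes (divides q' eq') =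
    cong u (*-cancelʳ-≡ q q' (2 ^ e) {{m^n≢0 2 e}} (trans (cancel2 (trans (sym (regroup q)) (sym eq))) eq'))
  ... | yes (divides q eq) | no ¬div = ⊥-elim (¬div (divides q (cancel2 (trans eq (regroup q)))))
  ... | no ¬div | yes (divides q' eq') = ⊥-elim (¬div (divides q' (trans (cong (_*ℕ 2) eq') (sym (regroup q')))))
  ... | no _ | no _ = refl

  spreadOdd : ∀ m → spread (suc e) u (suc (m *ℕ 2)) ≡ 0ℤ
  spreadOdd m with (2 ^ suc e) ∣? suc (m *ℕ 2)
  ... | yes (divides q eq) with () ← trans (sym (sucDouble%2 m)) (trans (cong (_% 2) (trans eq (regroup q))) (double%2 (q *ℕ 2 ^ e)))
  ... | no _ = refl

-- Every series a is divisible by a series b with b(0) = 1; the quotient is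
-- determined coefficient by coefficient by  q(n) = a(n) - Σ_{i<n} b(i+1) q(n-1-i).
module Division (b : ℕ → ℤ) (b₀ : b 0 ≡ 1ℤ) (a : ℕ → ℤ) where

  next : ℕ → (ℕ → ℤ) → ℤ
  next n f = a n - sumTo n (λ i → b (suc i) * f (n ∸ suc i))

  -- table n holds the first n quotient coefficients (and junk beyond).
  table : ℕ → ℕ → ℤ
  table zero _ = 0ℤ
  table (suc n) k with k <? n
  ... | yes _ = table n k
  ... | no _ = next n (table n)

  quotient : ℕ → ℤ
  quotient n = table (suc n) n

  quotient-table : ∀ n → quotient n ≡ next n (table n)
  quotient-table n with n <? n
  ... | yes n<n = ⊥-elim (<-irrefl refl n<n)
  ... | no _ = refl

  table-stable : ∀ n k → k < n → table n k ≡ quotient k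
  table-stable (suc n) k k<1+n with k <? n
  ... | yes k<n = table-stable n k k<n
  ... | no k≮n rewrite ≤-antisym (≤-pred k<1+n) (≮⇒≥ k≮n) = sym (quotient-table n)

  quotient-rec : ∀ n → quotient n ≡ next n quotient
  quotient-rec n = trans (quotient-table n) (cong (λ x → a n - x)
    (sumTo-cong n (λ i i<n → cong (b (suc i) *_) (table-stable n (n ∸ suc i) (below i<n)))))
    where
    below : ∀ {i n} → i < n → n ∸ suc i < n
    below {i} {suc n} _ = s≤s (m∸n≤m n i)

  -- b·quotient = a: the first term of the convolution is exactly the recurrence.
  division : ∀ n → conv b quotient n ≡ a n
  division n = begin
    conv b quotient n            ≡⟨ sumTo-shift n _ ⟩
    b 0 * quotient n + rest      ≡⟨ cong₂ (λ x y → x * y + rest) b₀ (quotient-rec n) ⟩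
    1ℤ * (a n - rest) + rest     ≡⟨ cancel (a n) rest ⟩
    a n                          ∎
    where
    open ≡-Reasoning
    rest = sumTo n (λ i → b (suc i) * quotient (n ∸ suc i))
    cancel : ∀ (x r : ℤ) → 1ℤ * (x - r) + r ≡ x
    cancel = solve-∀

twisted-doubling : ∀ c .{{_ : NonZero c}} (k : ℤ) {q q'} → SternDoubling q q' →
  (∀ n → t (c +ℕ n) ≡ k * q n) → ∀ n → t (c *ℕ 2 +ℕ n) ≡ (- k) * q' n
twisted-doubling (suc c) k {q} {q'} (q'Even , q'Odd) scaled = byParity _ evenCase oddCase
  where
  open ≡-Reasoning
  C = suc c

  evenCase : ∀ m → t (C *ℕ 2 +ℕ m *ℕ 2) ≡ (- k) * q' (m *ℕ 2)
  evenCase m = begin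
    t (C *ℕ 2 +ℕ m *ℕ 2)    ≡⟨ cong t (sym (*ℕ-distribʳ-+ 2 C m)) ⟩
    t ((C +ℕ m) *ℕ 2)       ≡⟨ t-even (C +ℕ m) ⟩
    - t (C +ℕ m)            ≡⟨ cong -_ (scaled m) ⟩
    - (k * q m)             ≡⟨ neg-distribˡ-* k (q m) ⟩
    (- k) * q m             ≡⟨ cong ((- k) *_) (sym (q'Even m)) ⟩
    (- k) * q' (m *ℕ 2)     ∎

  oddCase : ∀ m → t (C *ℕ 2 +ℕ suc (m *ℕ 2)) ≡ (- k) * q' (suc (m *ℕ 2))
  oddCase m = begin
    t (C *ℕ 2 +ℕ suc (m *ℕ 2))              ≡⟨ cong t (trans (+-suc (C *ℕ 2) (m *ℕ 2)) (cong suc (sym (*ℕ-distribʳ-+ 2 C m)))) ⟩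
    t (suc ((C +ℕ m) *ℕ 2))                 ≡⟨ t-odd (C +ℕ m) ⟩
    - t (C +ℕ m) + - t (suc (C +ℕ m))       ≡⟨ cong (λ x → - t (C +ℕ m) + - t x) (sym (+-suc C m)) ⟩
    - t (C +ℕ m) + - t (C +ℕ suc m)         ≡⟨ cong₂ (λ x y → - x + - y) (scaled m) (scaled (suc m)) ⟩
    - (k * q m) + - (k * q (suc m))         ≡⟨ factor k (q m) (q (suc m)) ⟩
    (- k) * (q m + q (suc m))               ≡⟨ cong ((- k) *_) (sym (q'Odd m)) ⟩
    (- k) * q' (suc (m *ℕ 2))               ∎
    where
    factor : ∀ (a x y : ℤ) → - (a * x) + - (a * y) ≡ (- a) * (x + y)
    factor = solve-∀

U : ℕ → ℤ
U = Division.quotient (λ k → s (suc k)) refl (λ n → t (4 +ℕ n))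

-- S·U = Σ t(3+n) zⁿ; the constant term uses s(0) = 0 = t(3).
U-quotient : ∀ n → conv s U n ≡ t (3 +ℕ n)
U-quotient zero = refl
U-quotient (suc n) = trans (conv-suc s U n refl) (Division.division (λ k → s (suc k)) refl (λ n → t (4 +ℕ n)) n)

twisted-scaling : ∀ e n → t (3 *ℕ 2 ^ e +ℕ n) ≡ (-1ℤ ^ℤ e) * conv s (spread e U) n
twisted-scaling zero n = sym (trans (*-identityˡ _) (trans (conv-congʳ s (spread-zero U) n) (U-quotient n)))
twisted-scaling (suc e) n = begin
  t (3 *ℕ 2 ^ suc e +ℕ n)
    ≡⟨ cong (λ c → t (c +ℕ n)) (trans (cong (3 *ℕ_) (*-comm 2 (2 ^ e))) (sym (*-assoc 3 (2 ^ e) 2))) ⟩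
  t (3 *ℕ 2 ^ e *ℕ 2 +ℕ n)
    ≡⟨ twisted-doubling (3 *ℕ 2 ^ e) {{m*n≢0 3 (2 ^ e)}} (-1ℤ ^ℤ e)
         {conv s (spread e U)} {conv s (spread (suc e) U)}
         (conv-dilation {spread e U} {spread (suc e) U} (spread-dilation e U)) (twisted-scaling e) n ⟩
  (- (-1ℤ ^ℤ e)) * conv s (spread (suc e) U) n
    ≡⟨ cong (_* conv s (spread (suc e) U) n) (sym (-1*i≡-i (-1ℤ ^ℤ e))) ⟩
  (-1ℤ ^ℤ suc e) * conv s (spread (suc e) U) n ∎
  where
  open ≡-Reasoning
  instance
    2^e≢0 : NonZero (2 ^ e)
    2^e≢0 = m^n≢0 2 e

theorem1p1 : Σ (ℕ → ℤ) (λ u →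
    (∀ n → conv s u n ≡ t (3 +ℕ n))
    × (∀ e n → t (3 *ℕ 2 ^ e +ℕ n) ≡ (-1ℤ ^ℤ e) *ℤ conv s (spread e u) n))
theorem1p1 = U , U-quotient , twisted-scaling
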